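{- Let $\lambda\in\mathbb{R}$, let $\alpha$ be a positive integer, let $m\in\mathbb{N}$ with $m\ge\alpha$, and let $x\in\mathbb{C}$ with $x\neq 0,1$. Then \[ \sum_{k=\alpha}^{m}(k)_{\alpha,\lambda}x^{k}=\frac{1}{x-1}\Big\{x^{m+1}H_{\alpha,\lambda}(m+1\,|\,x^{ -1})-x^{\alpha}H_{\alpha,\lambda}(\alpha\,|\,x^{ -1})\Big\}, \] and moreover \begin{align*} \frac{1}{x-1}\Big\{x^{m+1}H_{\alpha,\lambda}(m+1\,|\,x^{ -1})-x^{\alpha}H_{\alpha,\lambda}(\alpha\,|\,x^{ -1})\Big\}&=\sum_{k=1}^{m}S_{2,\lambda}(\alpha,k)\,k!\,x^{k}\sum_{l=0}^{m-k}\binom{l+k}{k}x^{l}\\ &\quad-\sum_{k=1}^{\alpha-1}S_{2,\lambda}(\alpha,k)\,k!\,x^{k}\sum_{l=0}^{\alpha-k-1}\binom{l+k}{k}x^{l}. \end{align*}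
   Context: For $\lambda\in\mathbb{R}$, the generalized falling factorial polynomials are $(x)_{0,\lambda}=1$ and $(x)_{n,\lambda}=x(x-\lambda)\cdots(x-(n-1)\lambda)$ for $n\ge1$; the ordinary falling factorial is $(x)_0=1$, $(x)_n=x(x-1)\cdots(x-n+1)$. The degenerate exponential is the formal power series $e_{\lambda}^{y}(t)=\sum_{n=0}^{\infty}(y)_{n,\lambda}\frac{t^{n}}{n!}$, and $e_\lambda(t)=e_\lambda^1(t)$. For $u\in\mathbb{C}$, $u\ne1$, the degenerate Frobenius–Euler polynomials $H_{n,\lambda}(y\,|\,u)$ are defined by $\frac{1-u}{e_{\lambda}(t)-u}e_{\lambda}^{y}(t)=\sum_{n=0}^{\infty}H_{n,\lambda}(y\,|\,u)\frac{t^{n}}{n!}$. The degenerate Stirling numbers of the second kind $S_{2,\lambda}(n,k)$ are defined by $(y)_{n,\lambda}=\sum_{k=0}^{n}S_{2,\lambda}(n,k)(y)_{k}$ for all $n\ge0$, with $S_{2,\lambda}(n,k)=0$ for $k>n$ or $k<0$. -}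

module Defs where

open import Level using (_⊔_)
open import Algebra.Bundles using (CommutativeRing)
open import Data.Nat using (ℕ; zero; suc; _∸_; _<_; _!) renaming (_+_ to _+ℕ_)
open import Data.Nat.Combinatorics using (_C_)
open import Data.Product using (Σ; _×_)
open import Relation.Nullary using (¬_)

-- Operations over an arbitrary commutative ring R (the paper works in ℂ).
module Ops {c ℓ} (R : CommutativeRing c ℓ) where
  open CommutativeRing R

  ι : ℕ → Carrier
  ι zero = 0#
  ι (suc n) = 1# + ι n

  pow : Carrier → ℕ → Carrier
  pow x zero = 1#
  pow x (suc n) = pow x n * x

  sumN : ℕ → (ℕ → Carrier) → Carrier
  sumN zero f = 0#
  sumN (suc n) f = sumN n f + f n

  -- sumFT a b f = Σ_{k=a}^{b} f k  (empty when b < a)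
  sumFT : ℕ → ℕ → (ℕ → Carrier) → Carrier
  sumFT a b f = sumN (suc b ∸ a) (λ i → f (a +ℕ i))

  fallλ : Carrier → Carrier → ℕ → Carrier
  fallλ lam y zero = 1#
  fallλ lam y (suc n) = fallλ lam y n * (y - ι n * lam)

  fall : Carrier → ℕ → Carrier
  fall y n = fallλ 1# y n

  -- S is (the table of) the degenerate Stirling numbers of the second kind:
  -- (y)_{n,λ} = Σ_{k=0}^{n} S(n,k) (y)_k for all n, y, and S(n,k) = 0 for k > n.
  IsDegStirling2 : Carrier → (ℕ → ℕ → Carrier) → Set (c ⊔ ℓ)
  IsDegStirling2 lam S =
    ((n : ℕ) (y : Carrier) → fallλ lam y n ≈ sumFT 0 n (λ k → S n k * fall y k))
    × ((n k : ℕ) → n < k → S n k ≈ 0#)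

  -- exponential coefficients of e_λ(t) - u
  hcoef : Carrier → Carrier → ℕ → Carrier
  hcoef lam u zero = 1# - u
  hcoef lam u (suc j) = fallλ lam 1# (suc j)

  -- H n y = H_{n,λ}(y | u): the exponential coefficients of the power series g with
  -- (e_λ(t) - u) · g(t) = (1 - u) e_λ^y(t)  (i.e. g = (1-u) e_λ^y(t) / (e_λ(t) - u)),
  -- written coefficientwise (Cauchy product of exponential generating functions).
  IsDegFrobEuler : Carrier → Carrier → (ℕ → Carrier → Carrier) → Set (c ⊔ ℓ)
  IsDegFrobEuler lam u H =
    (n : ℕ) (y : Carrier) →
      sumFT 0 n (λ j → ι (n C j) * hcoef lam u j * H (n ∸ j) y) ≈ (1# - u) * fallλ lam y n

  record IsCharZeroField : Set (c ⊔ ℓ) where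
    field
      inverse : (a : Carrier) → ¬ (a ≈ 0#) → Σ Carrier (λ b → a * b ≈ 1#)
      charZero : (n : ℕ) → ¬ (ι (suc n) ≈ 0#)

-- The defining relation (e_λ(t) - u) Σ H_n(y|u) tⁿ/n! = (1 - u) e_λ^y(t), together with
-- e_λ^{y+1}(t) = e_λ(t) e_λ^y(t) (a Vandermonde identity for (y)_{n,λ}), gives
-- H_n(y+1|u) - u H_n(y|u) = (1 - u) (y)_{n,λ}. With u = 1/x this makes x^k H_α(k|1/x) a discrete
-- antiderivative of (x - 1) (k)_{α,λ} x^k, so the first identity is a telescoping sum. For the
-- second, expand (k)_{α,λ} = Σ_j S_{2,λ}(α,j) j! C(k,j), exchange the order of summation, and use
-- x^j Σ_{l ≤ M-j} C(l+j,j) x^l = Σ_{k ≤ M} C(k,j) x^k for M = m and M = α - 1.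
{-# OPTIONS --safe #-}
module Submission where

open import Defs
open import Algebra.Bundles using (CommutativeRing)
open import Data.Nat using (ℕ; _≤_; _∸_; _!; suc) renaming (_+_ to _+ℕ_)
open import Data.Nat.Combinatorics using (_C_)
open import Data.Product using (_×_)
open import Relation.Nullary using (¬_)

open import Data.Nat using (zero; z≤n; s≤s; z<s; _<_) renaming (_*_ to _*ℕ_)
import Data.Nat.Properties as ℕ
open import Data.Nat.Combinatorics using (k>n⇒nCk≡0; nCk+nC[k+1]≡[n+1]C[k+1])
open import Data.Nat.Induction using (<-rec)
open import Data.Integer.Base as ℤ using (ℤ; +_; -[1+_]; _⊖_; +-*-rawRing)
import Data.Integer.Properties as ℤₚ
import Data.Sign.Base as Sign
open import Data.Maybe.Base using (Maybe; just; nothing)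
open import Data.Product using (_,_; <_,_>)
open import Function using (id)
open import Relation.Nullary using (yes; no)
import Relation.Binary.PropositionalEquality as P
open import Algebra.Solver.Ring.AlmostCommutativeRing
  using (fromCommutativeRing; _-Raw-AlmostCommutative⟶_)

-- The ring solver for R with integer coefficients: with coefficients taken from R itself the
-- normaliser could not see that 1# - 1# vanishes. The optimised n ×′ 1# makes ⟦ + 1 ⟧
-- definitionally 1#, so that con (+ 1) in a solver equation matches 1# in the goal.
module ℤ-Solver {c ℓ} (R : CommutativeRing c ℓ) where
  open CommutativeRing R
  open import Algebra.Properties.Ring ring using (-‿distribˡ-*; -‿distribʳ-*; -‿involutive; -0#≈0#; -‿+-comm)
  open import Algebra.Properties.Monoid.Mult.TCOptimised +-monoid using (1+×; ×-homo-+) renaming (_×_ to _×′_)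
  open import Algebra.Properties.Semiring.Mult.TCOptimised semiring using (×1-homo-*)
  open import Relation.Binary.Reasoning.Setoid setoid

  ⟦_⟧ : ℤ → Carrier
  ⟦ + n ⟧ = n ×′ 1#
  ⟦ -[1+ n ] ⟧ = - (suc n ×′ 1#)

  private
    [1+a]-[1+b]≈a-b : ∀ a b → (1# + a) - (1# + b) ≈ a - b
    [1+a]-[1+b]≈a-b a b = begin
      (1# + a) - (1# + b)     ≈⟨ +-congˡ (sym (-‿+-comm 1# b)) ⟩
      (1# + a) + (- 1# - b)   ≈⟨ +-congʳ (+-comm 1# a) ⟩
      (a + 1#) + (- 1# - b)   ≈⟨ +-assoc a 1# _ ⟩
      a + (1# + (- 1# - b))   ≈⟨ +-congˡ (sym (+-assoc 1# (- 1#) (- b))) ⟩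
      a + ((1# - 1#) - b)     ≈⟨ +-congˡ (+-congʳ (-‿inverseʳ 1#)) ⟩
      a + (0# - b)            ≈⟨ +-congˡ (+-identityˡ (- b)) ⟩
      a - b                   ∎

  ⊖-homo : ∀ m n → ⟦ m ⊖ n ⟧ ≈ m ×′ 1# - n ×′ 1#
  ⊖-homo zero zero = sym (-‿inverseʳ 0#)
  ⊖-homo (suc m) zero = sym (trans (+-congˡ -0#≈0#) (+-identityʳ _))
  ⊖-homo zero (suc n) = sym (+-identityˡ _)
  ⊖-homo (suc m) (suc n) = begin
    ⟦ suc m ⊖ suc n ⟧                 ≡⟨ P.cong ⟦_⟧ (ℤₚ.[1+m]⊖[1+n]≡m⊖n m n) ⟩
    ⟦ m ⊖ n ⟧                         ≈⟨ ⊖-homo m n ⟩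
    m ×′ 1# - n ×′ 1#                 ≈⟨ sym ([1+a]-[1+b]≈a-b _ _) ⟩
    (1# + m ×′ 1#) - (1# + n ×′ 1#)   ≈⟨ sym (+-cong (1+× m 1#) (-‿cong (1+× n 1#))) ⟩
    suc m ×′ 1# - suc n ×′ 1#         ∎

  +-homo : ∀ i j → ⟦ i ℤ.+ j ⟧ ≈ ⟦ i ⟧ + ⟦ j ⟧
  +-homo -[1+ m ] -[1+ n ] = begin
    - (suc (suc (m +ℕ n)) ×′ 1#)        ≡⟨ P.cong (λ k → - (suc k ×′ 1#)) (P.sym (ℕ.+-suc m n)) ⟩
    - ((suc m +ℕ suc n) ×′ 1#)          ≈⟨ -‿cong (×-homo-+ 1# (suc m) (suc n)) ⟩
    - (suc m ×′ 1# + suc n ×′ 1#)       ≈⟨ sym (-‿+-comm _ _) ⟩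
    - (suc m ×′ 1#) + - (suc n ×′ 1#)   ∎
  +-homo -[1+ m ] (+ n) = trans (⊖-homo n (suc m)) (+-comm _ _)
  +-homo (+ m) -[1+ n ] = ⊖-homo m (suc n)
  +-homo (+ m) (+ n) = ×-homo-+ 1# m n

  -‿homo : ∀ i → ⟦ ℤ.- i ⟧ ≈ - ⟦ i ⟧
  -‿homo -[1+ n ] = sym (-‿involutive _)
  -‿homo (+ zero) = sym -0#≈0#
  -‿homo (+ suc n) = refl

  +◃-homo : ∀ n → ⟦ Sign.+ ℤ.◃ n ⟧ ≈ n ×′ 1#
  +◃-homo zero = refl
  +◃-homo (suc n) = refl

  -◃-homo : ∀ n → ⟦ Sign.- ℤ.◃ n ⟧ ≈ - (n ×′ 1#)
  -◃-homo zero = sym -0#≈0#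
  -◃-homo (suc n) = refl

  *-homo : ∀ i j → ⟦ i ℤ.* j ⟧ ≈ ⟦ i ⟧ * ⟦ j ⟧
  *-homo (+ m) (+ n) = trans (+◃-homo (m *ℕ n)) (×1-homo-* m n)
  *-homo (+ zero) -[1+ n ] = sym (zeroˡ _)
  *-homo (+ suc m) -[1+ n ] = trans (-‿cong (×1-homo-* (suc m) (suc n))) (-‿distribʳ-* _ _)
  *-homo -[1+ m ] (+ n) = begin
    ⟦ Sign.- ℤ.◃ (suc m *ℕ n) ⟧   ≈⟨ -◃-homo (suc m *ℕ n) ⟩
    - ((suc m *ℕ n) ×′ 1#)        ≈⟨ -‿cong (×1-homo-* (suc m) n) ⟩
    - (suc m ×′ 1# * n ×′ 1#)     ≈⟨ -‿distribˡ-* _ _ ⟩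
    - (suc m ×′ 1#) * n ×′ 1#     ∎
  *-homo -[1+ m ] -[1+ n ] = begin
    (suc m *ℕ suc n) ×′ 1#   ≈⟨ ×1-homo-* (suc m) (suc n) ⟩
    a * b                    ≈⟨ sym (-‿involutive _) ⟩
    - - (a * b)              ≈⟨ -‿cong (-‿distribˡ-* a b) ⟩
    - (- a * b)              ≈⟨ -‿distribʳ-* (- a) b ⟩
    - a * - b                ∎
    where a = suc m ×′ 1#; b = suc n ×′ 1#

  morphism : +-*-rawRing -Raw-AlmostCommutative⟶ fromCommutativeRing R
  morphism = record
    { ⟦_⟧ = ⟦_⟧ ; +-homo = +-homo ; *-homo = *-homo ; -‿homo = -‿homo
    ; 0-homo = refl ; 1-homo = refl }

  ⟦⟧-≟ : ∀ i j → Maybe (⟦ i ⟧ ≈ ⟦ j ⟧)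
  ⟦⟧-≟ i j with i ℤₚ.≟ j
  ... | yes P.refl = just refl
  ... | no _ = nothing

  open import Algebra.Solver.Ring +-*-rawRing (fromCommutativeRing R) morphism ⟦⟧-≟ public
    using (solve; _:=_; _:+_; _:*_; _:-_; con)

module FiniteSums {c ℓ} (R : CommutativeRing c ℓ) where
  open CommutativeRing R
  open Ops R
  open ℤ-Solver R
  open import Relation.Binary.Reasoning.Setoid setoid

  sumN-cong-< : ∀ n {f g : ℕ → Carrier} → (∀ i → i < n → f i ≈ g i) → sumN n f ≈ sumN n g
  sumN-cong-< zero f≈g = refl
  sumN-cong-< (suc n) f≈g =
    +-cong (sumN-cong-< n (λ i i<n → f≈g i (ℕ.m<n⇒m<1+n i<n))) (f≈g n ℕ.≤-refl)

  sumN-cong : ∀ n {f g : ℕ → Carrier} → (∀ i → f i ≈ g i) → sumN n f ≈ sumN n g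
  sumN-cong n f≈g = sumN-cong-< n (λ i _ → f≈g i)

  sumN-zero : ∀ n {f : ℕ → Carrier} → (∀ i → i < n → f i ≈ 0#) → sumN n f ≈ 0#
  sumN-zero zero f≈0 = refl
  sumN-zero (suc n) f≈0 = trans
    (+-cong (sumN-zero n (λ i i<n → f≈0 i (ℕ.m<n⇒m<1+n i<n))) (f≈0 n ℕ.≤-refl))
    (+-identityˡ 0#)

  sumN-*ˡ : ∀ n a (f : ℕ → Carrier) → sumN n (λ i → a * f i) ≈ a * sumN n f
  sumN-*ˡ zero a f = sym (zeroʳ a)
  sumN-*ˡ (suc n) a f = trans (+-congʳ (sumN-*ˡ n a f)) (sym (distribˡ a _ _))

  sumN-*ʳ : ∀ n a (f : ℕ → Carrier) → sumN n (λ i → f i * a) ≈ sumN n f * a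
  sumN-*ʳ n a f = begin
    sumN n (λ i → f i * a)   ≈⟨ sumN-cong n (λ i → *-comm (f i) a) ⟩
    sumN n (λ i → a * f i)   ≈⟨ sumN-*ˡ n a f ⟩
    a * sumN n f             ≈⟨ *-comm a _ ⟩
    sumN n f * a             ∎

  sumN-+ : ∀ n (f g : ℕ → Carrier) → sumN n (λ i → f i + g i) ≈ sumN n f + sumN n g
  sumN-+ zero f g = sym (+-identityˡ 0#)
  sumN-+ (suc n) f g = trans (+-congʳ (sumN-+ n f g))
    (solve 4 (λ a b a' b' → (a :+ b) :+ (a' :+ b') := (a :+ a') :+ (b :+ b')) refl _ _ _ _)

  sumN-- : ∀ n (f g : ℕ → Carrier) → sumN n (λ i → f i - g i) ≈ sumN n f - sumN n g
  sumN-- zero f g = sym (-‿inverseʳ 0#)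
  sumN-- (suc n) f g = trans (+-congʳ (sumN-- n f g))
    (solve 4 (λ a b a' b' → (a :- b) :+ (a' :- b') := (a :+ a') :- (b :+ b')) refl _ _ _ _)

  sumN-+ℕ : ∀ a b (f : ℕ → Carrier) → sumN (a +ℕ b) f ≈ sumN a f + sumN b (λ i → f (a +ℕ i))
  sumN-+ℕ a zero f = trans (reflexive (P.cong (λ k → sumN k f) (ℕ.+-identityʳ a))) (sym (+-identityʳ _))
  sumN-+ℕ a (suc b) f = begin
    sumN (a +ℕ suc b) f                                     ≡⟨ P.cong (λ k → sumN k f) (ℕ.+-suc a b) ⟩
    sumN (a +ℕ b) f + f (a +ℕ b)                            ≈⟨ +-congʳ (sumN-+ℕ a b f) ⟩
    (sumN a f + sumN b (λ i → f (a +ℕ i))) + f (a +ℕ b)     ≈⟨ +-assoc _ _ _ ⟩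
    sumN a f + sumN (suc b) (λ i → f (a +ℕ i))              ∎

  sumN-suc-head : ∀ n (f : ℕ → Carrier) → sumN (suc n) f ≈ f 0 + sumN n (λ i → f (suc i))
  sumN-suc-head zero f = trans (+-identityˡ _) (sym (+-identityʳ _))
  sumN-suc-head (suc n) f = trans (+-congʳ (sumN-suc-head n f)) (+-assoc _ _ _)

  sumN-comm : ∀ n p (g : ℕ → ℕ → Carrier) →
    sumN n (λ k → sumN p (g k)) ≈ sumN p (λ i → sumN n (λ k → g k i))
  sumN-comm zero p g = sym (sumN-zero p (λ _ _ → refl))
  sumN-comm (suc n) p g = trans (+-congʳ (sumN-comm n p g)) (sym (sumN-+ p _ _))

  sumN-vanishing-tail : ∀ {n N} (f : ℕ → Carrier) → (∀ i → n ≤ i → f i ≈ 0#) → n ≤ N →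
    sumN N f ≈ sumN n f
  sumN-vanishing-tail {n} {N} f tail≈0 n≤N = begin
    sumN N f                                          ≡⟨ P.cong (λ k → sumN k f) (P.sym (ℕ.m+[n∸m]≡n n≤N)) ⟩
    sumN (n +ℕ (N ∸ n)) f                             ≈⟨ sumN-+ℕ n (N ∸ n) f ⟩
    sumN n f + sumN (N ∸ n) (λ i → f (n +ℕ i))
      ≈⟨ +-congˡ (sumN-zero (N ∸ n) (λ i _ → tail≈0 (n +ℕ i) (ℕ.m≤m+n n i))) ⟩
    sumN n f + 0#                                     ≈⟨ +-identityʳ _ ⟩
    sumN n f                                          ∎

  sumN-vanishing-head : ∀ {k N} (f : ℕ → Carrier) → (∀ i → i < k → f i ≈ 0#) → k ≤ N →
    sumN N f ≈ sumN (N ∸ k) (λ i → f (k +ℕ i))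
  sumN-vanishing-head {k} {N} f head≈0 k≤N = begin
    sumN N f                                          ≡⟨ P.cong (λ n → sumN n f) (P.sym (ℕ.m+[n∸m]≡n k≤N)) ⟩
    sumN (k +ℕ (N ∸ k)) f                             ≈⟨ sumN-+ℕ k (N ∸ k) f ⟩
    sumN k f + sumN (N ∸ k) (λ i → f (k +ℕ i))        ≈⟨ +-congʳ (sumN-zero k head≈0) ⟩
    0# + sumN (N ∸ k) (λ i → f (k +ℕ i))              ≈⟨ +-identityˡ _ ⟩
    sumN (N ∸ k) (λ i → f (k +ℕ i))                   ∎

  sumN-telescope : ∀ a n (F : ℕ → Carrier) →
    sumN n (λ i → F (suc (a +ℕ i)) - F (a +ℕ i)) ≈ F (a +ℕ n) - F a
  sumN-telescope a zero F = begin
    0#                 ≈⟨ sym (-‿inverseʳ (F a)) ⟩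
    F a - F a          ≡⟨ P.cong (λ k → F k - F a) (P.sym (ℕ.+-identityʳ a)) ⟩
    F (a +ℕ 0) - F a   ∎
  sumN-telescope a (suc n) F = begin
    sumN n (λ i → F (suc (a +ℕ i)) - F (a +ℕ i)) + (F (suc (a +ℕ n)) - F (a +ℕ n))
      ≈⟨ +-congʳ (sumN-telescope a n F) ⟩
    (F (a +ℕ n) - F a) + (F (suc (a +ℕ n)) - F (a +ℕ n))
      ≈⟨ solve 3 (λ p q r → (p :- q) :+ (r :- p) := r :- q) refl _ _ _ ⟩
    F (suc (a +ℕ n)) - F a
      ≡⟨ P.cong (λ k → F k - F a) (P.sym (ℕ.+-suc a n)) ⟩
    F (a +ℕ suc n) - F a ∎

module FallingFactorials {c ℓ} (R : CommutativeRing c ℓ) where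
  open CommutativeRing R
  open Ops R
  open ℤ-Solver R
  open FiniteSums R
  open import Relation.Binary.Reasoning.Setoid setoid

  x≈0⇒x*y*z≈0 : ∀ {x} y z → x ≈ 0# → x * y * z ≈ 0#
  x≈0⇒x*y*z≈0 y z x≈0 = trans (*-congʳ (*-congʳ x≈0)) (trans (*-congʳ (zeroˡ y)) (zeroˡ z))

  ι-+ : ∀ m n → ι (m +ℕ n) ≈ ι m + ι n
  ι-+ zero n = sym (+-identityˡ _)
  ι-+ (suc m) n = trans (+-congˡ (ι-+ m n)) (sym (+-assoc _ _ _))

  ι-* : ∀ m n → ι (m *ℕ n) ≈ ι m * ι n
  ι-* zero n = sym (zeroˡ _)
  ι-* (suc m) n = begin
    ι (n +ℕ m *ℕ n)         ≈⟨ ι-+ n (m *ℕ n) ⟩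
    ι n + ι (m *ℕ n)        ≈⟨ +-cong (sym (*-identityˡ _)) (ι-* m n) ⟩
    1# * ι n + ι m * ι n    ≈⟨ sym (distribʳ _ _ _) ⟩
    (1# + ι m) * ι n        ∎

  ι-pascal : ∀ n k → ι (suc n C suc k) ≈ ι (n C k) + ι (n C suc k)
  ι-pascal n k = trans (reflexive (P.cong ι (P.sym (nCk+nC[k+1]≡[n+1]C[k+1] n k)))) (ι-+ (n C k) (n C suc k))

  ι-C-> : ∀ {n k} → n < k → ι (n C k) ≈ 0#
  ι-C-> n<k = reflexive (P.cong ι (k>n⇒nCk≡0 n<k))

  pow-+ : ∀ x a b → pow x (a +ℕ b) ≈ pow x a * pow x b
  pow-+ x zero b = sym (*-identityˡ _)
  pow-+ x (suc a) b = trans (*-congʳ (pow-+ x a b))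
    (solve 3 (λ p q y → p :* q :* y := p :* y :* q) refl _ _ _)

  fallλ-cong : ∀ lam {y z} n → y ≈ z → fallλ lam y n ≈ fallλ lam z n
  fallλ-cong lam zero y≈z = refl
  fallλ-cong lam (suc n) y≈z = *-cong (fallλ-cong lam n y≈z) (+-congʳ y≈z)

  fallλ-suc : ∀ lam y n → fallλ lam y (suc n) ≈ y * fallλ lam (y - lam) n
  fallλ-suc lam y zero = solve 2 (λ y l → con (+ 1) :* (y :- con (+ 0) :* l) := y :* con (+ 1)) refl y lam
  fallλ-suc lam y (suc n) = begin
    fallλ lam y (suc n) * (y - (1# + ι n) * lam)             ≈⟨ *-congʳ (fallλ-suc lam y n) ⟩
    (y * fallλ lam (y - lam) n) * (y - (1# + ι n) * lam)
      ≈⟨ solve 4 (λ y F t l → (y :* F) :* (y :- (con (+ 1) :+ t) :* l) := y :* (F :* ((y :- l) :- t :* l)))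
                 refl y _ (ι n) lam ⟩
    y * (fallλ lam (y - lam) n * ((y - lam) - ι n * lam))    ∎

  fallλ-0# : ∀ lam n → fallλ lam 0# (suc n) ≈ 0#
  fallλ-0# lam n = trans (fallλ-suc lam 0# n) (zeroˡ _)

  fall-suc : ∀ y k → fall (1# + y) (suc k) ≈ fall y (suc k) + ι (suc k) * fall y k
  fall-suc y k = begin
    fall (1# + y) (suc k)                ≈⟨ fallλ-suc 1# (1# + y) k ⟩
    (1# + y) * fall ((1# + y) - 1#) k
      ≈⟨ *-congˡ (fallλ-cong 1# k (solve 1 (λ y → (con (+ 1) :+ y) :- con (+ 1) := y) refl y)) ⟩
    (1# + y) * fall y k
      ≈⟨ solve 3 (λ y q t → (con (+ 1) :+ y) :* q := q :* (y :- t :* con (+ 1)) :+ (con (+ 1) :+ t) :* q) refl y _ (ι k) ⟩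
    fall y (suc k) + ι (suc k) * fall y k ∎

  fall-ι : ∀ J k → fall (ι J) k ≈ ι (k !) * ι (J C k)
  fall-ι J zero = solve 0 (con (+ 1) := (con (+ 1) :+ con (+ 0)) :* (con (+ 1) :+ con (+ 0))) refl
  fall-ι zero (suc k) = trans (fallλ-0# 1# k) (sym (zeroʳ _))
  fall-ι (suc J) (suc k) = begin
    fall (1# + ι J) (suc k)                                                  ≈⟨ fall-suc (ι J) k ⟩
    fall (ι J) (suc k) + ι (suc k) * fall (ι J) k                            ≈⟨ +-cong (fall-ι J (suc k)) (*-congˡ (fall-ι J k)) ⟩
    ι (suc k !) * ι (J C suc k) + ι (suc k) * (ι (k !) * ι (J C k))          ≈⟨ +-congʳ (*-congʳ (ι-* (suc k) (k !))) ⟩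
    (ι (suc k) * ι (k !)) * ι (J C suc k) + ι (suc k) * (ι (k !) * ι (J C k))
      ≈⟨ solve 4 (λ s f c₀ c₁ → (s :* f) :* c₁ :+ s :* (f :* c₀) := (s :* f) :* (c₀ :+ c₁)) refl _ _ _ _ ⟩
    (ι (suc k) * ι (k !)) * (ι (J C k) + ι (J C suc k))                      ≈⟨ *-cong (sym (ι-* (suc k) (k !))) (sym (ι-pascal J k)) ⟩
    ι (suc k !) * ι (suc J C suc k)                                          ∎

module BinomialConvolution {c ℓ} (R : CommutativeRing c ℓ) where
  open CommutativeRing R
  open Ops R
  open ℤ-Solver R
  open FiniteSums R
  open FallingFactorials R
  open import Relation.Binary.Reasoning.Setoid setoid

  binomialConv : ℕ → (ℕ → Carrier) → (ℕ → Carrier) → Carrier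
  binomialConv n f g = sumN (suc n) (λ j → ι (n C j) * f j * g (n ∸ j))

  binomialConv-cong : ∀ n {f f′ g g′ : ℕ → Carrier} → (∀ j → f j ≈ f′ j) → (∀ j → g j ≈ g′ j) →
    binomialConv n f g ≈ binomialConv n f′ g′
  binomialConv-cong n f≈f′ g≈g′ = sumN-cong (suc n) (λ j → *-cong (*-congˡ (f≈f′ j)) (g≈g′ _))

  binomialConv-*ˡ : ∀ n a (f g : ℕ → Carrier) → binomialConv n (λ j → a * f j) g ≈ a * binomialConv n f g
  binomialConv-*ˡ n a f g = trans
    (sumN-cong (suc n) (λ j → solve 4 (λ c a f g → c :* (a :* f) :* g := a :* (c :* f :* g)) refl _ a _ _))
    (sumN-*ˡ (suc n) a _)

  binomialConv-*ʳ : ∀ n a (f g : ℕ → Carrier) → binomialConv n f (λ j → a * g j) ≈ a * binomialConv n f g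
  binomialConv-*ʳ n a f g = trans
    (sumN-cong (suc n) (λ j → solve 4 (λ c a f g → c :* f :* (a :* g) := a :* (c :* f :* g)) refl _ a _ _))
    (sumN-*ˡ (suc n) a _)

  binomialConv--ʳ : ∀ n (f g g′ : ℕ → Carrier) →
    binomialConv n f (λ j → g j - g′ j) ≈ binomialConv n f g - binomialConv n f g′
  binomialConv--ʳ n f g g′ = trans
    (sumN-cong (suc n) (λ j → solve 3 (λ a b b′ → a :* (b :- b′) := a :* b :- a :* b′) refl _ _ _))
    (sumN-- (suc n) _ _)

  -- The Leibniz rule (FG)′ = F′G + FG′ for exponential generating functions.
  binomialConv-suc : ∀ n (f g : ℕ → Carrier) →
    binomialConv (suc n) f g ≈ binomialConv n (λ j → f (suc j)) g + binomialConv n f (λ j → g (suc j))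
  binomialConv-suc n f g = begin
    binomialConv (suc n) f g                                              ≈⟨ sumN-suc-head (suc n) _ ⟩
    t₀ + sumN (suc n) (λ i → ι (suc n C suc i) * f (suc i) * g (n ∸ i))   ≈⟨ +-congˡ (sumN-cong (suc n) pascal) ⟩
    t₀ + sumN (suc n) (λ i → ι (n C i) * f (suc i) * g (n ∸ i) + term i)  ≈⟨ +-congˡ (sumN-+ (suc n) _ term) ⟩
    t₀ + (X + sumN (suc n) term)                                          ≈⟨ +-congˡ (+-congˡ drop-last) ⟩
    t₀ + (X + Y)                                                          ≈⟨ solve 3 (λ t x y → t :+ (x :+ y) := x :+ (t :+ y)) refl t₀ X Y ⟩
    X + (t₀ + Y)                                                          ≈⟨ +-congˡ (sym (sumN-suc-head n _)) ⟩
    X + binomialConv n f (λ j → g (suc j))                                ∎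
    where
    t₀ = ι (n C 0) * f 0 * g (suc n)
    X = binomialConv n (λ j → f (suc j)) g
    term : ℕ → Carrier
    term i = ι (n C suc i) * f (suc i) * g (n ∸ i)
    Y = sumN n (λ i → ι (n C suc i) * f (suc i) * g (suc (n ∸ suc i)))
    pascal : ∀ i → ι (suc n C suc i) * f (suc i) * g (n ∸ i) ≈ ι (n C i) * f (suc i) * g (n ∸ i) + term i
    pascal i = trans (*-congʳ (*-congʳ (ι-pascal n i))) (trans (*-congʳ (distribʳ _ _ _)) (distribʳ _ _ _))
    drop-last : sumN (suc n) term ≈ Y
    drop-last = begin
      sumN n term + term n   ≈⟨ +-congˡ (x≈0⇒x*y*z≈0 _ _ (ι-C-> (ℕ.n<1+n n))) ⟩
      sumN n term + 0#       ≈⟨ +-identityʳ _ ⟩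
      sumN n term            ≈⟨ sumN-cong-< n (λ i i<n → *-congˡ (reflexive (P.cong g (ℕ.+-∸-assoc 1 i<n)))) ⟩
      Y                      ∎

  fallλ-vandermonde : ∀ lam n a b → fallλ lam (a + b) n ≈ binomialConv n (fallλ lam a) (fallλ lam b)
  fallλ-vandermonde lam zero a b = solve 0 (con (+ 1) := con (+ 0) :+ (con (+ 1) :+ con (+ 0)) :* con (+ 1) :* con (+ 1)) refl
  fallλ-vandermonde lam (suc n) a b = begin
    fallλ lam (a + b) (suc n)
      ≈⟨ fallλ-suc lam (a + b) n ⟩
    (a + b) * fallλ lam ((a + b) - lam) n
      ≈⟨ distribʳ _ _ _ ⟩
    a * fallλ lam ((a + b) - lam) n + b * fallλ lam ((a + b) - lam) n
      ≈⟨ +-cong (*-congˡ (fallλ-cong lam n (solve 3 (λ a b l → (a :+ b) :- l := (a :- l) :+ b) refl a b lam)))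
                (*-congˡ (fallλ-cong lam n (solve 3 (λ a b l → (a :+ b) :- l := a :+ (b :- l)) refl a b lam))) ⟩
    a * fallλ lam ((a - lam) + b) n + b * fallλ lam (a + (b - lam)) n
      ≈⟨ +-cong (*-congˡ (fallλ-vandermonde lam n (a - lam) b)) (*-congˡ (fallλ-vandermonde lam n a (b - lam))) ⟩
    a * binomialConv n (fallλ lam (a - lam)) (fallλ lam b) + b * binomialConv n (fallλ lam a) (fallλ lam (b - lam))
      ≈⟨ sym (+-cong (binomialConv-*ˡ n a (fallλ lam (a - lam)) (fallλ lam b))
                     (binomialConv-*ʳ n b (fallλ lam a) (fallλ lam (b - lam)))) ⟩
    binomialConv n (λ j → a * fallλ lam (a - lam) j) (fallλ lam b) + binomialConv n (fallλ lam a) (λ j → b * fallλ lam (b - lam) j)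
      ≈⟨ sym (+-cong (binomialConv-cong n {g = fallλ lam b} (fallλ-suc lam a) (λ _ → refl))
                     (binomialConv-cong n (λ _ → refl) (fallλ-suc lam b))) ⟩
    binomialConv n (λ j → fallλ lam a (suc j)) (fallλ lam b) + binomialConv n (fallλ lam a) (λ j → fallλ lam b (suc j))
      ≈⟨ sym (binomialConv-suc n (fallλ lam a) (fallλ lam b)) ⟩
    binomialConv (suc n) (fallλ lam a) (fallλ lam b) ∎

  binomialConv-cancelˡ : ∀ (h φ : ℕ → Carrier) (w : Carrier) → w * h 0 ≈ 1# →
    (∀ n → binomialConv n h φ ≈ 0#) → ∀ n → φ n ≈ 0#
  binomialConv-cancelˡ h φ w w*h₀≈1 conv≈0 = <-rec (λ n → φ n ≈ 0#) step
    where
    step : ∀ n → (∀ {i} → i < n → φ i ≈ 0#) → φ n ≈ 0#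
    step n ih = begin
      φ n                                         ≈⟨ sym (*-identityˡ _) ⟩
      1# * φ n                                    ≈⟨ *-congʳ (sym w*h₀≈1) ⟩
      w * h 0 * φ n
        ≈⟨ solve 3 (λ w h φ → w :* h :* φ := w :* ((con (+ 1) :+ con (+ 0)) :* h :* φ :+ con (+ 0))) refl w (h 0) (φ n) ⟩
      w * (ι (n C 0) * h 0 * φ n + 0#)            ≈⟨ *-congˡ (+-congˡ (sym (sumN-zero n tail≈0))) ⟩
      w * (ι (n C 0) * h 0 * φ n + sumN n tail)   ≈⟨ *-congˡ (sym (sumN-suc-head n _)) ⟩
      w * binomialConv n h φ                      ≈⟨ *-congˡ (conv≈0 n) ⟩
      w * 0#                                      ≈⟨ zeroʳ w ⟩
      0#                                          ∎
      where
      tail : ℕ → Carrier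
      tail i = ι (n C suc i) * h (suc i) * φ (n ∸ suc i)
      tail≈0 : ∀ i → i < n → tail i ≈ 0#
      tail≈0 i i<n = trans (*-congˡ (ih (ℕ.∸-monoʳ-< z<s i<n))) (zeroʳ _)

module FrobeniusEuler {c ℓ} (R : CommutativeRing c ℓ) where
  open CommutativeRing R
  open Ops R
  open ℤ-Solver R
  open FiniteSums R
  open FallingFactorials R
  open BinomialConvolution R
  open import Relation.Binary.Reasoning.Setoid setoid

  hcoef-binomialConv : ∀ lam u n (F : ℕ → Carrier) →
    binomialConv n (hcoef lam u) F ≈ binomialConv n (fallλ lam 1#) F - u * F n
  hcoef-binomialConv lam u n F = begin
    binomialConv n (hcoef lam u) F                     ≈⟨ sumN-suc-head n _ ⟩
    ι (n C 0) * (1# - u) * F n + t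
      ≈⟨ solve 3 (λ u q t → (con (+ 1) :+ con (+ 0)) :* (con (+ 1) :- u) :* q :+ t
                            := ((con (+ 1) :+ con (+ 0)) :* con (+ 1) :* q :+ t) :- u :* q) refl u (F n) t ⟩
    (ι (n C 0) * 1# * F n + t) - u * F n               ≈⟨ +-congʳ (sym (sumN-suc-head n _)) ⟩
    binomialConv n (fallλ lam 1#) F - u * F n          ∎
    where t = sumN n (λ i → ι (n C suc i) * fallλ lam 1# (suc i) * F (n ∸ suc i))

  -- e_λ^{y+1}(t) = e_λ(t) e_λ^y(t) read through the defining relation of H: the defect has zero
  -- convolution with hcoef, whose constant term 1 - u is a unit.
  frobeniusEuler-shift : ∀ lam u (H : ℕ → Carrier → Carrier) → IsDegFrobEuler lam u H →
    (w : Carrier) → w * (1# - u) ≈ 1# →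
    ∀ n y → H n (1# + y) - u * H n y ≈ (1# - u) * fallλ lam y n
  frobeniusEuler-shift lam u H isFE w w*v≈1 n y = begin
    A n - u * B n                    ≈⟨ solve 2 (λ a b → a := (a :- b) :+ b) refl _ _ ⟩
    defect n + v * F n               ≈⟨ +-congʳ (binomialConv-cancelˡ h defect w w*v≈1 conv-defect≈0 n) ⟩
    0# + v * F n                     ≈⟨ +-identityˡ _ ⟩
    v * F n                          ∎
    where
    h = hcoef lam u
    v = 1# - u
    A B F defect : ℕ → Carrier
    A k = H k (1# + y)
    B k = H k y
    F k = fallλ lam y k
    defect k = (A k - u * B k) - v * F k
    conv-defect≈0 : ∀ k → binomialConv k h defect ≈ 0#
    conv-defect≈0 k = begin
      binomialConv k h defect
        ≈⟨ binomialConv--ʳ k h (λ j → A j - u * B j) (λ j → v * F j) ⟩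
      binomialConv k h (λ j → A j - u * B j) - binomialConv k h (λ j → v * F j)
        ≈⟨ +-cong (trans (binomialConv--ʳ k h A (λ j → u * B j)) (+-congˡ (-‿cong (binomialConv-*ʳ k u h B))))
                  (-‿cong (binomialConv-*ʳ k v h F)) ⟩
      (binomialConv k h A - u * binomialConv k h B) - v * binomialConv k h F
        ≈⟨ +-cong (+-cong (isFE k (1# + y)) (-‿cong (*-congˡ (isFE k y))))
                  (-‿cong (*-congˡ (trans (hcoef-binomialConv lam u k F)
                                          (+-congʳ (sym (fallλ-vandermonde lam k 1# y)))))) ⟩
      (v * fallλ lam (1# + y) k - u * (v * F k)) - v * (fallλ lam (1# + y) k - u * F k)
        ≈⟨ solve 4 (λ v p u q → (v :* p :- u :* (v :* q)) :- v :* (p :- u :* q) := con (+ 0)) refl v _ u _ ⟩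
      0# ∎

  sumFT-fallλ-pow≈frobeniusEuler : ∀ lam α m → α ≤ m → (x xinv d : Carrier) → x * xinv ≈ 1# → (x - 1#) * d ≈ 1# →
    (H : ℕ → Carrier → Carrier) → IsDegFrobEuler lam xinv H →
    sumFT α m (λ k → fallλ lam (ι k) α * pow x k) ≈ d * (pow x (suc m) * H α (ι (suc m)) - pow x α * H α (ι α))
  sumFT-fallλ-pow≈frobeniusEuler lam α m α≤m x xinv d x*xinv≈1 [x-1]*d≈1 H isFE = begin
    sumFT α m f                                        ≈⟨ sym (*-identityˡ _) ⟩
    1# * sumFT α m f                                   ≈⟨ *-congʳ (sym [x-1]*d≈1) ⟩
    (x - 1#) * d * sumFT α m f                         ≈⟨ solve 3 (λ a d s → a :* d :* s := d :* (a :* s)) refl _ d _ ⟩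
    d * ((x - 1#) * sumFT α m f)                       ≈⟨ *-congˡ (sym (sumN-*ˡ N (x - 1#) _)) ⟩
    d * sumN N (λ i → (x - 1#) * f (α +ℕ i))           ≈⟨ *-congˡ (sumN-cong N (λ i → sym (G-step (α +ℕ i)))) ⟩
    d * sumN N (λ i → G (suc (α +ℕ i)) - G (α +ℕ i))   ≈⟨ *-congˡ (sumN-telescope α N G) ⟩
    d * (G (α +ℕ N) - G α)                             ≡⟨ P.cong (λ k → d * (G k - G α)) (ℕ.m+[n∸m]≡n (ℕ.m≤n⇒m≤1+n α≤m)) ⟩
    d * (G (suc m) - G α)                              ∎
    where
    N = suc m ∸ α
    f G : ℕ → Carrier
    f k = fallλ lam (ι k) α * pow x k
    G k = pow x k * H α (ι k)
    -- the inverse of 1 - 1/x is x/(x - 1)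
    inverse : x * d * (1# - xinv) ≈ 1#
    inverse = begin
      x * d * (1# - xinv)     ≈⟨ solve 3 (λ x d y → x :* d :* (con (+ 1) :- y) := (x :- x :* y) :* d) refl x d xinv ⟩
      (x - x * xinv) * d      ≈⟨ *-congʳ (+-congˡ (-‿cong x*xinv≈1)) ⟩
      (x - 1#) * d            ≈⟨ [x-1]*d≈1 ⟩
      1#                      ∎
    G-step : ∀ k → G (suc k) - G k ≈ (x - 1#) * f k
    G-step k = begin
      p * x * A - p * B
        ≈⟨ solve 5 (λ p x a b y → p :* x :* a :- p :* b := p :* x :* (a :- y :* b) :+ (x :* y) :* (p :* b) :- p :* b)
                   refl p x A B xinv ⟩
      p * x * (A - xinv * B) + (x * xinv) * (p * B) - p * B
        ≈⟨ +-congʳ (+-cong (*-congˡ (frobeniusEuler-shift lam xinv H isFE (x * d) inverse α (ι k))) (*-congʳ x*xinv≈1)) ⟩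
      p * x * ((1# - xinv) * Fk) + 1# * (p * B) - p * B
        ≈⟨ solve 5 (λ p x a b y → p :* x :* ((con (+ 1) :- y) :* a) :+ con (+ 1) :* (p :* b) :- p :* b
                                  := (x :- x :* y) :* (a :* p)) refl p x Fk B xinv ⟩
      (x - x * xinv) * (Fk * p)
        ≈⟨ *-congʳ (+-congˡ (-‿cong x*xinv≈1)) ⟩
      (x - 1#) * f k ∎
      where
      p = pow x k
      A = H α (1# + ι k)
      B = H α (ι k)
      Fk = fallλ lam (ι k) α

module StirlingExpansion {c ℓ} (R : CommutativeRing c ℓ) where
  open CommutativeRing R
  open Ops R
  open ℤ-Solver R
  open FiniteSums R
  open FallingFactorials R
  open import Algebra.Properties.Ring ring using (x[y-z]≈xy-xz)
  open import Relation.Binary.Reasoning.Setoid setoid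

  stirling-S[1+a,0]≈0 : ∀ {lam S} → IsDegStirling2 lam S → ∀ a → S (suc a) 0 ≈ 0#
  stirling-S[1+a,0]≈0 {lam} {S} (expansion , _) a = begin
    S α 0                                                      ≈⟨ solve 1 (λ s → s := s :* con (+ 1) :+ con (+ 0)) refl (S α 0) ⟩
    S α 0 * fall 0# 0 + 0#
      ≈⟨ +-congˡ (sym (sumN-zero α (λ i _ → trans (*-congˡ (fallλ-0# 1# i)) (zeroʳ _)))) ⟩
    S α 0 * fall 0# 0 + sumN α (λ i → S α (suc i) * fall 0# (suc i))  ≈⟨ sym (sumN-suc-head α _) ⟩
    sumFT 0 α (λ k → S α k * fall 0# k)                        ≈⟨ sym (expansion α 0#) ⟩
    fallλ lam 0# α                                             ≈⟨ fallλ-0# lam a ⟩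
    0#                                                         ∎
    where α = suc a

  fallλ-ι≈stirlingSum : ∀ {lam S} → IsDegStirling2 lam S → ∀ a m → suc a ≤ m → ∀ J →
    fallλ lam (ι J) (suc a) ≈ sumN m (λ i → S (suc a) (suc i) * ι (suc i !) * ι (J C suc i))
  fallλ-ι≈stirlingSum {lam} {S} isS@(expansion , S≈0) a m α≤m J = begin
    fallλ lam (ι J) α                               ≈⟨ expansion α (ι J) ⟩
    sumN (suc α) (λ k → S α k * fall (ι J) k)
      ≈⟨ sumN-cong (suc α) (λ k → trans (*-congˡ (fall-ι J k)) (sym (*-assoc _ _ _))) ⟩
    sumN (suc α) g                                  ≈⟨ sym (sumN-vanishing-tail g g≈0 (s≤s α≤m)) ⟩
    sumN (suc m) g                                  ≈⟨ sumN-suc-head m g ⟩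
    g 0 + sumN m (λ i → g (suc i))                  ≈⟨ +-congʳ (x≈0⇒x*y*z≈0 _ _ (stirling-S[1+a,0]≈0 isS a)) ⟩
    0# + sumN m (λ i → g (suc i))                   ≈⟨ +-identityˡ _ ⟩
    sumN m (λ i → g (suc i))                        ∎
    where
    α = suc a
    g : ℕ → Carrier
    g k = S α k * ι (k !) * ι (J C k)
    g≈0 : ∀ k → α < k → g k ≈ 0#
    g≈0 k α<k = x≈0⇒x*y*z≈0 _ _ (S≈0 α k α<k)

  binomialPowerSum : Carrier → ℕ → ℕ → Carrier
  binomialPowerSum x k M = sumN (suc M) (λ j → ι (j C k) * pow x j)

  binomialPowerSum-vanishing : ∀ x {k M} → M < k → binomialPowerSum x k M ≈ 0#
  binomialPowerSum-vanishing x M<k =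
    sumN-zero _ (λ j j≤M → trans (*-congʳ (ι-C-> (ℕ.<-≤-trans j≤M M<k))) (zeroˡ _))

  pow-binomialSum : ∀ x k M → k ≤ M →
    pow x k * sumFT 0 (M ∸ k) (λ l → ι ((l +ℕ k) C k) * pow x l) ≈ binomialPowerSum x k M
  pow-binomialSum x k M k≤M = sym (begin
    sumN (suc M) q                                               ≈⟨ sumN-vanishing-head q q≈0 (ℕ.m≤n⇒m≤1+n k≤M) ⟩
    sumN (suc M ∸ k) (λ i → q (k +ℕ i))                          ≡⟨ P.cong (λ n → sumN n (λ i → q (k +ℕ i))) (ℕ.+-∸-assoc 1 k≤M) ⟩
    sumN (suc (M ∸ k)) (λ i → q (k +ℕ i))                        ≈⟨ sumN-cong (suc (M ∸ k)) shift ⟩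
    sumN (suc (M ∸ k)) (λ l → pow x k * (ι ((l +ℕ k) C k) * pow x l))  ≈⟨ sumN-*ˡ (suc (M ∸ k)) _ _ ⟩
    pow x k * sumFT 0 (M ∸ k) (λ l → ι ((l +ℕ k) C k) * pow x l) ∎)
    where
    q : ℕ → Carrier
    q j = ι (j C k) * pow x j
    q≈0 : ∀ j → j < k → q j ≈ 0#
    q≈0 j j<k = trans (*-congʳ (ι-C-> j<k)) (zeroˡ _)
    shift : ∀ i → q (k +ℕ i) ≈ pow x k * (ι ((i +ℕ k) C k) * pow x i)
    shift i = begin
      ι ((k +ℕ i) C k) * pow x (k +ℕ i)        ≈⟨ *-cong (reflexive (P.cong (λ n → ι (n C k)) (ℕ.+-comm k i))) (pow-+ x k i) ⟩
      ι ((i +ℕ k) C k) * (pow x k * pow x i)   ≈⟨ solve 3 (λ c p r → c :* (p :* r) := p :* (c :* r)) refl _ _ _ ⟩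
      pow x k * (ι ((i +ℕ k) C k) * pow x i)   ∎

  binomialPowerSum-difference : ∀ x k {a m} → a ≤ m →
    binomialPowerSum x k m - binomialPowerSum x k a ≈ sumFT (suc a) m (λ j → ι (j C k) * pow x j)
  binomialPowerSum-difference x k {a} {m} a≤m = begin
    sumN (suc m) q - Q                             ≡⟨ P.cong (λ n → sumN n q - Q) (P.sym (ℕ.m+[n∸m]≡n (s≤s a≤m))) ⟩
    sumN (suc a +ℕ N) q - Q                        ≈⟨ +-congʳ (sumN-+ℕ (suc a) N q) ⟩
    (Q + sumN N (λ i → q (suc a +ℕ i))) - Q        ≈⟨ solve 2 (λ p w → (p :+ w) :- p := w) refl _ _ ⟩
    sumN N (λ i → q (suc a +ℕ i))                  ∎
    where
    N = suc m ∸ suc a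
    q : ℕ → Carrier
    q j = ι (j C k) * pow x j
    Q = binomialPowerSum x k a

  sumFT-fallλ-pow≈stirlingSum : ∀ {lam S} → IsDegStirling2 lam S → ∀ a m → suc a ≤ m → ∀ x →
    sumN m (λ i → S (suc a) (suc i) * ι (suc i !) * (binomialPowerSum x (suc i) m - binomialPowerSum x (suc i) a))
    ≈ sumFT (suc a) m (λ k → fallλ lam (ι k) (suc a) * pow x k)
  sumFT-fallλ-pow≈stirlingSum {lam} {S} isS a m α≤m x = begin
    sumN m (λ i → T i * (binomialPowerSum x (suc i) m - binomialPowerSum x (suc i) a))
      ≈⟨ sumN-cong m (λ i → *-congˡ (binomialPowerSum-difference x (suc i) (ℕ.≤-trans (ℕ.n≤1+n a) α≤m))) ⟩
    sumN m (λ i → T i * sumN N (λ j → ι ((α +ℕ j) C suc i) * pow x (α +ℕ j)))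
      ≈⟨ sumN-cong m (λ i → sym (sumN-*ˡ N _ _)) ⟩
    sumN m (λ i → sumN N (λ j → T i * (ι ((α +ℕ j) C suc i) * pow x (α +ℕ j))))
      ≈⟨ sumN-comm m N _ ⟩
    sumN N (λ j → sumN m (λ i → T i * (ι ((α +ℕ j) C suc i) * pow x (α +ℕ j))))
      ≈⟨ sumN-cong N (λ j → trans (sumN-cong m (λ i → sym (*-assoc _ _ _)))
                                  (trans (sumN-*ʳ m _ _) (*-congʳ (sym (fallλ-ι≈stirlingSum isS a m α≤m (α +ℕ j)))))) ⟩
    sumFT α m (λ k → fallλ lam (ι k) α * pow x k) ∎
    where
    α = suc a
    N = suc m ∸ α
    T : ℕ → Carrier
    T i = S α (suc i) * ι (suc i !)

  stirlingBinomialSums≈sumFT : ∀ {lam S} → IsDegStirling2 lam S → ∀ a m → suc a ≤ m → ∀ x →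
    sumFT 1 m (λ k → S (suc a) k * ι (k !) * pow x k * sumFT 0 (m ∸ k) (λ l → ι ((l +ℕ k) C k) * pow x l))
      - sumFT 1 (suc a ∸ 1) (λ k → S (suc a) k * ι (k !) * pow x k
                                     * sumFT 0 (suc a ∸ k ∸ 1) (λ l → ι ((l +ℕ k) C k) * pow x l))
    ≈ sumFT (suc a) m (λ k → fallλ lam (ι k) (suc a) * pow x k)
  stirlingBinomialSums≈sumFT {lam} {S} isS a m α≤m x = begin
    sumN m (λ i → T i * pow x (suc i) * inner (suc i) (m ∸ suc i))
      - sumN a (λ i → T i * pow x (suc i) * inner (suc i) (a ∸ i ∸ 1))
      ≈⟨ +-cong (sumN-cong-< m (λ i i<m → trans (*-assoc _ _ _) (*-congˡ (pow-binomialSum x (suc i) m i<m))))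
                (-‿cong (sumN-cong-< a (λ i i<a → trans (*-assoc _ _ _)
                  (*-congˡ (trans (*-congˡ (reflexive (P.cong (inner (suc i)) (a∸i∸1≡a∸[1+i] i))))
                                  (pow-binomialSum x (suc i) a i<a)))))) ⟩
    sumN m (λ i → T i * Q i m) - sumN a (λ i → T i * Q i a)
      ≈⟨ +-congˡ (-‿cong (sym (sumN-vanishing-tail _ T*Q[i,a]≈0 (ℕ.≤-trans (ℕ.n≤1+n a) α≤m)))) ⟩
    sumN m (λ i → T i * Q i m) - sumN m (λ i → T i * Q i a)
      ≈⟨ sym (sumN-- m _ _) ⟩
    sumN m (λ i → T i * Q i m - T i * Q i a)
      ≈⟨ sumN-cong m (λ i → sym (x[y-z]≈xy-xz (T i) _ _)) ⟩
    sumN m (λ i → T i * (Q i m - Q i a))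
      ≈⟨ sumFT-fallλ-pow≈stirlingSum isS a m α≤m x ⟩
    sumFT (suc a) m (λ k → fallλ lam (ι k) (suc a) * pow x k) ∎
    where
    T : ℕ → Carrier
    T i = S (suc a) (suc i) * ι (suc i !)
    inner : ℕ → ℕ → Carrier
    inner k n = sumFT 0 n (λ l → ι ((l +ℕ k) C k) * pow x l)
    Q : ℕ → ℕ → Carrier
    Q i = binomialPowerSum x (suc i)
    a∸i∸1≡a∸[1+i] : ∀ i → a ∸ i ∸ 1 P.≡ a ∸ suc i
    a∸i∸1≡a∸[1+i] i = P.trans (ℕ.∸-+-assoc a i 1) (P.cong (a ∸_) (ℕ.+-comm i 1))
    T*Q[i,a]≈0 : ∀ i → a ≤ i → T i * Q i a ≈ 0#
    T*Q[i,a]≈0 i a≤i = trans (*-congˡ (binomialPowerSum-vanishing x (s≤s a≤i))) (zeroʳ _)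

theorem5 : ∀ {c ℓ} (R : CommutativeRing c ℓ) →
  let open CommutativeRing R
      open Ops R
  in IsCharZeroField →
     (lam : Carrier) (α : ℕ) → 1 ≤ α → (m : ℕ) → α ≤ m →
     (x : Carrier) → ¬ (x ≈ 0#) → ¬ (x ≈ 1#) →
     (xinv : Carrier) → x * xinv ≈ 1# →
     (d : Carrier) → (x - 1#) * d ≈ 1# →
     (S : ℕ → ℕ → Carrier) → IsDegStirling2 lam S →
     (H : ℕ → Carrier → Carrier) → IsDegFrobEuler lam xinv H →
     (sumFT α m (λ k → fallλ lam (ι k) α * pow x k)
        ≈ d * (pow x (suc m) * H α (ι (suc m)) - pow x α * H α (ι α)))
     × (d * (pow x (suc m) * H α (ι (suc m)) - pow x α * H α (ι α))
        ≈ sumFT 1 m (λ k → S α k * ι (k !) * pow x k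
                       * sumFT 0 (m ∸ k) (λ l → ι ((l +ℕ k) C k) * pow x l))
          - sumFT 1 (α ∸ 1) (λ k → S α k * ι (k !) * pow x k
                       * sumFT 0 (α ∸ k ∸ 1) (λ l → ι ((l +ℕ k) C k) * pow x l)))
theorem5 R _ lam (suc a) (s≤s z≤n) m α≤m x _ _ xinv x*xinv≈1 d [x-1]*d≈1 S isS H isFE =
  < id , (λ powerSum≈frobeniusEuler → trans (sym powerSum≈frobeniusEuler)
                                            (sym (stirlingBinomialSums≈sumFT isS a m α≤m x))) >
    (sumFT-fallλ-pow≈frobeniusEuler lam (suc a) m α≤m x xinv d x*xinv≈1 [x-1]*d≈1 H isFE)
  where
  open CommutativeRing R using (trans; sym)
  open FrobeniusEuler R using (sumFT-fallλ-pow≈frobeniusEuler)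
  open StirlingExpansion R using (stirlingBinomialSums≈sumFT)
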